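{- Let $k,n\in\mathbb{N}$, let $q$ be a prime, let $m=\Theta(k^2\log n)$, let $B\subseteq\mathbb{F}_q^m$ with $|B|=n$, and let $\ell:=12\log_q n$. Select $\ell$ matrices $A_1,\ldots,A_\ell\in\mathbb{F}_q^{k\times m}$ uniformly and independently at random, and for $\vec b\in\mathbb{F}_q^m$ let $g(\vec{b}):=(A_1\vec{b},\ldots,A_\ell\vec{b})\in\mathbb{F}_q^{k\ell}$. Let $\tilde{B}_2:=\{\gamma_1\vec{b}_1+\gamma_2\vec{b}_2:\gamma_1,\gamma_2\in\mathbb{F}_q,\ \vec{b}_1,\vec{b}_2\in B\}$. Suppose $q>2^{12k}$ but $q=O_k(1)$. Then with probability at least $1-\frac{O_k(1)}{n}$, for every distinct $\vec{b}_1,\vec{b}_2\in\tilde{B}_2$ and every linearly independent $\vec{a}_1,\vec{a}_2\in\mathbb{F}_q^k$, we have $$\left\|\mathcal{M}(\vec{a}_1,g(\vec{b}_1))-\mathcal{M}(\vec{a}_2,g(\vec{b}_2))\right\|\ge\frac{1}{2}.$$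
   Context: For $t,d\in\mathbb{N}$, $\mathcal{M}:\mathbb{F}_q^d\times\mathbb{F}_q^{td}\to\mathbb{F}_q^t$ is defined by $\mathcal{M}(\vec{a},(\vec{b}_1,\ldots,\vec{b}_t)):=(\langle\vec{a},\vec{b}_1\rangle,\ldots,\langle\vec{a},\vec{b}_t\rangle)$ where each $\vec b_i\in\mathbb{F}_q^d$ and $\langle\vec a,\vec b\rangle=\sum_i a_ib_i$ over $\mathbb{F}_q$; here $d=k$, $t=\ell$, so $\mathcal{M}(\vec a,g(\vec b))=(\vec a^{T}A_1\vec b,\ldots,\vec a^{T}A_\ell\vec b)\in\mathbb{F}_q^\ell$. For $x,y\in\mathbb{F}_q^\ell$, $\|x-y\|$ denotes relative Hamming distance (fraction of coordinates where they differ). $O_k(1)$ denotes a quantity bounded by a function of $k$ only. -}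

module Defs where

open import Data.Nat using (ℕ; zero; suc; _+_; _*_; _≤_; _<_; NonZero)
open import Data.Nat.DivMod using (_mod_)
open import Data.Fin using (Fin; toℕ; _≟_)
open import Data.Product using (_×_; Σ; ∃)
open import Data.List using (List; length)
open import Data.List.Relation.Unary.Any using (Any)
open import Relation.Nullary using (¬_; yes; no)
open import Relation.Binary.PropositionalEquality using (_≡_)

-- The prime field F_q, realised as Fin q with arithmetic mod q.
𝔽 : ℕ → Set
𝔽 q = Fin q

module _ {q : ℕ} {{_ : NonZero q}} where

  0F : 𝔽 q
  0F = 0 mod q

  _+F_ : 𝔽 q → 𝔽 q → 𝔽 q
  a +F b = (toℕ a + toℕ b) mod q

  _*F_ : 𝔽 q → 𝔽 q → 𝔽 q
  a *F b = (toℕ a * toℕ b) mod q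

  sumF : (d : ℕ) → (Fin d → 𝔽 q) → 𝔽 q
  sumF zero    f = 0F
  sumF (suc d) f = f Fin.zero +F sumF d (λ i → f (Fin.suc i))

  dot : {d : ℕ} → (Fin d → 𝔽 q) → (Fin d → 𝔽 q) → 𝔽 q
  dot {d} a b = sumF d (λ i → a i *F b i)

  lin2 : {d : ℕ} → 𝔽 q → (Fin d → 𝔽 q) → 𝔽 q → (Fin d → 𝔽 q) → (Fin d → 𝔽 q)
  lin2 γ₁ v₁ γ₂ v₂ j = (γ₁ *F v₁ j) +F (γ₂ *F v₂ j)

  matVec : {k m : ℕ} → (Fin k → Fin m → 𝔽 q) → (Fin m → 𝔽 q) → (Fin k → 𝔽 q)
  matVec {m = m} A b r = dot (A r) b

  -- g(b) = (A₁ b, …, A_ℓ b) ∈ F_q^{kℓ}, stored as ℓ blocks of length k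
  g : {ℓ k m : ℕ} → (Fin ℓ → Fin k → Fin m → 𝔽 q) → (Fin m → 𝔽 q) → (Fin ℓ → Fin k → 𝔽 q)
  g As b i = matVec (As i) b

  𝓜 : {d t : ℕ} → (Fin d → 𝔽 q) → (Fin t → Fin d → 𝔽 q) → (Fin t → 𝔽 q)
  𝓜 a bs i = dot a (bs i)

  LinIndep2 : {d : ℕ} → (Fin d → 𝔽 q) → (Fin d → 𝔽 q) → Set
  LinIndep2 a₁ a₂ = ∀ γ₁ γ₂ → (∀ j → lin2 γ₁ a₁ γ₂ a₂ j ≡ 0F) → (γ₁ ≡ 0F × γ₂ ≡ 0F)

_≈v_ : {A : Set} {d : ℕ} → (Fin d → A) → (Fin d → A) → Set
v ≈v w = ∀ j → v j ≡ w j

hamming : {q t : ℕ} → (Fin t → 𝔽 q) → (Fin t → 𝔽 q) → ℕ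
hamming {t = zero}  x y = 0
hamming {t = suc t} x y with x Fin.zero ≟ y Fin.zero
... | yes _ = hamming {t = t} (λ i → x (Fin.suc i)) (λ i → y (Fin.suc i))
... | no  _ = suc (hamming {t = t} (λ i → x (Fin.suc i)) (λ i → y (Fin.suc i)))

-- relative Hamming distance ‖x − y‖ = hamming x y / t is ≥ 1/2
RelDistAtLeastHalf : {q t : ℕ} → (Fin t → 𝔽 q) → (Fin t → 𝔽 q) → Set
RelDistAtLeastHalf {t = t} x y = t ≤ 2 * hamming x y

-- B ⊆ F_q^m with |B| = n, given as an injective enumeration
InjectiveFamily : {q m n : ℕ} → (Fin n → Fin m → 𝔽 q) → Set
InjectiveFamily {n = n} B = ∀ (i j : Fin n) → B i ≈v B j → i ≡ j

-- ℓ = ⌈12 log_q n⌉ : the least ℓ with n^12 ≤ q^ℓ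
open import Data.Nat using (_^_; _∸_)
IsCeil12Log : (q n ℓ : ℕ) → Set
IsCeil12Log q n ℓ = (n ^ 12 ≤ q ^ ℓ) × (∀ ℓ' → n ^ 12 ≤ q ^ ℓ' → ℓ ≤ ℓ')

Good : {q : ℕ} {{_ : NonZero q}} (k m ℓ n : ℕ) →
       (Fin n → Fin m → 𝔽 q) → (Fin ℓ → Fin k → Fin m → 𝔽 q) → Set
Good {q} k m ℓ n B As =
  ∀ (γ₁ γ₂ γ₃ γ₄ : 𝔽 q) (i₁ i₂ i₃ i₄ : Fin n) →
  let b₁ = lin2 γ₁ (B i₁) γ₂ (B i₂)
      b₂ = lin2 γ₃ (B i₃) γ₄ (B i₄)
  in ¬ (b₁ ≈v b₂) →
     ∀ (a₁ a₂ : Fin k → 𝔽 q) → LinIndep2 a₁ a₂ →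
     RelDistAtLeastHalf (𝓜 a₁ (g As b₁)) (𝓜 a₂ (g As b₂))

-- "at most N of the q^(ℓkm) choices are bad": the bad choices are covered
-- (up to pointwise equality) by a list of length ≤ N.
PointwiseEq3 : {A : Set} {ℓ k m : ℕ} → (Fin ℓ → Fin k → Fin m → A) → (Fin ℓ → Fin k → Fin m → A) → Set
PointwiseEq3 M M' = ∀ i j r → M i j r ≡ M' i j r

BadCoveredBy : {q : ℕ} {{_ : NonZero q}} (k m ℓ n : ℕ) → (Fin n → Fin m → 𝔽 q) →
               List (Fin ℓ → Fin k → Fin m → 𝔽 q) → Set
BadCoveredBy k m ℓ n B L =
  ∀ As → ¬ Good k m ℓ n B As → Any (PointwiseEq3 As) L

-- Union bound over the choices behind a bad event: the coefficients γ and indices i describing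
-- b₁, b₂ ∈ B̃₂ (n⁴q⁴ choices) and the vectors a₁, a₂ (q^{2k} choices).  For one such choice with
-- b₁ ≠ b₂ and a₁, a₂ independent, A ↦ a₁ᵀAb₁ − a₂ᵀAb₂ is a linear form on F_q^{k×m} with nonzero
-- coefficient matrix a₁b₁ᵀ − a₂b₂ᵀ, so a random block A_i makes the two coordinates of 𝓜 agree with
-- probability at most 1/q.  Distance below 1/2 needs agreement in more than ℓ/2 of the ℓ independent
-- blocks, which has probability at most 2^ℓ q^{-(⌊ℓ/2⌋+1)} ≤ n⁻⁵ since q ≥ 2¹² and q^ℓ ≥ n¹².
-- Altogether at most a q^{4+2k}/n fraction of the q^{ℓkm} choices of (A₁,…,A_ℓ) is bad.
module Submission where

open import Data.Bool using (Bool; true; false; T)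
open import Data.Empty using (⊥-elim)
open import Data.Fin using (Fin; zero; suc; toℕ)
import Data.Fin.Properties as Finₚ
open import Data.Integer using (∣_∣; _⊖_) renaming (+_ to pos; _+_ to _+ℤ_; _-_ to _-ℤ_; _*_ to _*ℤ_)
open import Data.Integer.Divisibility.Signed
  using (divides; ∣ᵤ⇒∣; ∣⇒∣ᵤ; ∣m∣n⇒∣m-n) renaming (_∣_ to _∣ℤ_)
import Data.Integer.Properties as ℤₚ
import Data.Integer.Tactic.RingSolver as ℤ-Solver
open import Data.List
  using (List; []; _∷_; _++_; [_]; length; map; filterᵇ; concatMap; cartesianProductWith; cartesianProduct; tabulate; allFin)
open import Data.List.Membership.Propositional.Properties using (∈-allFin; ∈-cartesianProduct⁺)
open import Data.List.Properties using (length-++; length-tabulate)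
open import Data.List.Relation.Unary.Any using (Any; here; there; any?)
import Data.List.Relation.Unary.Any as Any
open import Data.List.Relation.Unary.Any.Properties using (cartesianProductWith⁺; cartesianProduct⁺; concatMap⁺)
open import Data.Nat
  using (ℕ; zero; suc; _+_; _*_; _^_; _∸_; _%_; _/_; _≤_; _<_; _≤?_; _≤ᵇ_; _≡ᵇ_; z≤n; s≤s;
         NonZero; >-nonZero; >-nonZero⁻¹; ⌊_/2⌋; ⌈_/2⌉)
  renaming (_≟_ to _ℕ≟_)
open import Data.Nat.DivMod
  using (_mod_; m%n<n; %-distribˡ-+; %-distribˡ-*; m%n%n≡m%n; [m+kn]%n≡m%n; m≡m%n+[m/n]*n; m<n⇒m%n≡m; n%n≡0)
open import Data.Nat.Divisibility using (_∣_) renaming (divides to dividesℕ)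
open import Data.Nat.Logarithm using (⌈log₂_⌉)
open import Data.Nat.Primality using (Prime; euclidsLemma)
open import Data.Nat.Properties
open import Data.Nat.Tactic.RingSolver using (solve-∀)
open import Algebra.Properties.CommutativeSemigroup +-commutativeSemigroup
  using () renaming (interchange to +-interchange)
open import Algebra.Properties.CommutativeSemigroup *-commutativeSemigroup
  using () renaming (x∙yz≈y∙xz to *-leftComm)
open import Algebra.Properties.Semiring.Sum +-*-semiring using (sum; sum-cong-≗; sum-syntax; *-distribˡ-sum)
open import Data.Product using (_×_; ∃; ∃-syntax; _,_)
open import Data.Sum using (inj₁; inj₂; [_,_]′)
open import Data.Unit using (tt)
open import Data.Vec.Functional as Vector using (Vector)
open import Function using (_∘_; id)
open import Relation.Binary.PropositionalEquality
  using (_≡_; _≢_; refl; sym; trans; cong; cong₂; subst; subst₂; module ≡-Reasoning)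
open import Relation.Nullary using (¬_; Dec; yes; no; ¬?; contradiction)
open import Relation.Nullary.Decidable using (decidable-stable)
open import Relation.Unary using (_⟨×⟩_)

open import Defs

private variable
  A B C : Set

∑ˡ : List A → (A → ℕ) → ℕ
∑ˡ []       f = 0
∑ˡ (x ∷ xs) f = f x + ∑ˡ xs f

syntax ∑ˡ xs (λ x → e) = ∑[ x ∈ xs ] e

𝟙 : Bool → ℕ
𝟙 true  = 1
𝟙 false = 0

count : (A → Bool) → List A → ℕ
count p xs = ∑[ x ∈ xs ] 𝟙 (p x)

∑-cong : (xs : List A) {f g : A → ℕ} → (∀ x → f x ≡ g x) → ∑ˡ xs f ≡ ∑ˡ xs g
∑-cong []       f≗g = refl
∑-cong (x ∷ xs) f≗g = cong₂ _+_ (f≗g x) (∑-cong xs f≗g)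

∑-mono-≤ : (xs : List A) {f g : A → ℕ} → (∀ x → f x ≤ g x) → ∑ˡ xs f ≤ ∑ˡ xs g
∑-mono-≤ []       f≤g = z≤n
∑-mono-≤ (x ∷ xs) f≤g = +-mono-≤ (f≤g x) (∑-mono-≤ xs f≤g)

∑-const : (xs : List A) (c : ℕ) → ∑[ _ ∈ xs ] c ≡ length xs * c
∑-const []       c = refl
∑-const (x ∷ xs) c = cong (c +_) (∑-const xs c)

∑-distrib-+ : (xs : List A) (f g : A → ℕ) → ∑[ x ∈ xs ] (f x + g x) ≡ ∑ˡ xs f + ∑ˡ xs g
∑-distrib-+ []       f g = refl
∑-distrib-+ (x ∷ xs) f g = begin
  f x + g x + ∑[ y ∈ xs ] (f y + g y) ≡⟨ cong (f x + g x +_) (∑-distrib-+ xs f g) ⟩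
  f x + g x + (∑ˡ xs f + ∑ˡ xs g)     ≡⟨ +-interchange (f x) (g x) _ _ ⟩
  f x + ∑ˡ xs f + (g x + ∑ˡ xs g)     ∎
  where open ≡-Reasoning

*-distribˡ-∑ : (xs : List A) (c : ℕ) (f : A → ℕ) → c * ∑ˡ xs f ≡ ∑[ x ∈ xs ] (c * f x)
*-distribˡ-∑ []       c f = *-zeroʳ c
*-distribˡ-∑ (x ∷ xs) c f = trans (*-distribˡ-+ c (f x) _) (cong (c * f x +_) (*-distribˡ-∑ xs c f))

*-distribʳ-∑ : (xs : List A) (c : ℕ) (f : A → ℕ) → ∑ˡ xs f * c ≡ ∑[ x ∈ xs ] (f x * c)
*-distribʳ-∑ xs c f =
  trans (*-comm (∑ˡ xs f) c) (trans (*-distribˡ-∑ xs c f) (∑-cong xs (λ x → *-comm c (f x))))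

∑-bound : (xs : List A) {f : A → ℕ} (c b : ℕ) → (∀ x → f x * c ≤ b) → ∑ˡ xs f * c ≤ length xs * b
∑-bound []       c b bound = z≤n
∑-bound (x ∷ xs) {f} c b bound = begin
  (f x + ∑ˡ xs f) * c       ≡⟨ *-distribʳ-+ c (f x) (∑ˡ xs f) ⟩
  f x * c + ∑ˡ xs f * c     ≤⟨ +-mono-≤ (bound x) (∑-bound xs c b bound) ⟩
  b + length xs * b         ∎
  where open ≤-Reasoning

∑-comm : (xs : List A) (ys : List B) (f : A → B → ℕ) →
         ∑[ x ∈ xs ] ∑[ y ∈ ys ] f x y ≡ ∑[ y ∈ ys ] ∑[ x ∈ xs ] f x y
∑-comm []       ys f = sym (trans (∑-const ys 0) (*-zeroʳ (length ys)))
∑-comm (x ∷ xs) ys f =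
  trans (cong (∑ˡ ys (f x) +_) (∑-comm xs ys f)) (sym (∑-distrib-+ ys (f x) _))

∑-++ : (xs ys : List A) (f : A → ℕ) → ∑ˡ (xs ++ ys) f ≡ ∑ˡ xs f + ∑ˡ ys f
∑-++ []       ys f = refl
∑-++ (x ∷ xs) ys f = trans (cong (f x +_) (∑-++ xs ys f)) (sym (+-assoc (f x) _ _))

∑-map : (g : A → B) (xs : List A) (f : B → ℕ) → ∑ˡ (map g xs) f ≡ ∑[ x ∈ xs ] f (g x)
∑-map g []       f = refl
∑-map g (x ∷ xs) f = cong (f (g x) +_) (∑-map g xs f)

∑-cartesianProductWith : (h : A → B → C) (xs : List A) (ys : List B) (f : C → ℕ) →
  ∑ˡ (cartesianProductWith h xs ys) f ≡ ∑[ x ∈ xs ] ∑[ y ∈ ys ] f (h x y)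
∑-cartesianProductWith h []       ys f = refl
∑-cartesianProductWith h (x ∷ xs) ys f = begin
  ∑ˡ (map (h x) ys ++ cartesianProductWith h xs ys) f
    ≡⟨ ∑-++ (map (h x) ys) _ f ⟩
  ∑ˡ (map (h x) ys) f + ∑ˡ (cartesianProductWith h xs ys) f
    ≡⟨ cong₂ _+_ (∑-map (h x) ys f) (∑-cartesianProductWith h xs ys f) ⟩
  ∑[ y ∈ ys ] f (h x y) + ∑[ x′ ∈ xs ] ∑[ y ∈ ys ] f (h x′ y) ∎
  where open ≡-Reasoning

length≡∑1 : (xs : List A) → length xs ≡ ∑[ _ ∈ xs ] 1
length≡∑1 xs = sym (trans (∑-const xs 1) (*-identityʳ (length xs)))

length-concatMap : (g : A → List B) (xs : List A) → length (concatMap g xs) ≡ ∑[ x ∈ xs ] length (g x)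
length-concatMap g []       = refl
length-concatMap g (x ∷ xs) = trans (length-++ (g x)) (cong (length (g x) +_) (length-concatMap g xs))

length-cartesianProduct : (xs : List A) (ys : List B) →
                          length (cartesianProduct xs ys) ≡ length xs * length ys
length-cartesianProduct xs ys = begin
  length (cartesianProduct xs ys)    ≡⟨ length≡∑1 (cartesianProduct xs ys) ⟩
  ∑ˡ (cartesianProduct xs ys) _      ≡⟨ ∑-cartesianProductWith _,_ xs ys _ ⟩
  ∑[ x ∈ xs ] ∑[ y ∈ ys ] 1          ≡⟨ ∑-cong xs (λ _ → sym (length≡∑1 ys)) ⟩
  ∑[ x ∈ xs ] length ys              ≡⟨ ∑-const xs (length ys) ⟩
  length xs * length ys              ∎
  where open ≡-Reasoning

length-filterᵇ : (p : A → Bool) (xs : List A) → length (filterᵇ p xs) ≡ count p xs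
length-filterᵇ p []       = refl
length-filterᵇ p (x ∷ xs) with p x
... | true  = cong suc (length-filterᵇ p xs)
... | false = length-filterᵇ p xs

filterᵇ⁺ : (p : A → Bool) {Q : A → Set} {xs : List A} →
           Any (λ x → Q x × T (p x)) xs → Any Q (filterᵇ p xs)
filterᵇ⁺ p {xs = x ∷ xs} (here (qx , px)) with p x
... | true = here qx
filterᵇ⁺ p {xs = x ∷ xs} (there any) with p x
... | true  = there (filterᵇ⁺ p any)
... | false = filterᵇ⁺ p any

length-allFin : ∀ n → length (allFin n) ≡ n
length-allFin n = length-tabulate id

count-tabulate-≡0 : ∀ {n} (f : Fin n → A) (p : A → Bool) →
  (∀ i → ¬ T (p (f i))) → count p (tabulate f) ≡ 0
count-tabulate-≡0 {n = zero}  f p none = refl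
count-tabulate-≡0 {n = suc n} f p none with p (f zero) in eq
... | true  = ⊥-elim (none zero (subst T (sym eq) tt))
... | false = count-tabulate-≡0 (f ∘ suc) p (none ∘ suc)

count-tabulate-≤1 : ∀ {n} (f : Fin n → A) (p : A → Bool) →
  (∀ i j → T (p (f i)) → T (p (f j)) → i ≡ j) → count p (tabulate f) ≤ 1
count-tabulate-≤1 {n = zero}  f p unique = z≤n
count-tabulate-≤1 {n = suc n} f p unique with p (f zero) in eq
... | true  = ≤-reflexive (cong suc (count-tabulate-≡0 (f ∘ suc) p
                (λ i pi → Finₚ.0≢1+n (unique zero (suc i) (subst T (sym eq) tt) pi))))
... | false = count-tabulate-≤1 (f ∘ suc) p
                (λ i j pi pj → Finₚ.suc-injective (unique (suc i) (suc j) pi pj))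

functions : (d : ℕ) → List A → List (Vector A d)
functions zero    xs = [ Vector.[] ]
functions (suc d) xs = cartesianProductWith Vector._∷_ xs (functions d xs)

length-functions : (d : ℕ) (xs : List A) → length (functions d xs) ≡ length xs ^ d
length-functions zero    xs = refl
length-functions (suc d) xs = begin
  length (functions (suc d) xs)               ≡⟨ length≡∑1 (functions (suc d) xs) ⟩
  ∑ˡ (functions (suc d) xs) _                 ≡⟨ ∑-cartesianProductWith Vector._∷_ xs (functions d xs) _ ⟩
  ∑[ x ∈ xs ] ∑[ t ∈ functions d xs ] 1       ≡⟨ ∑-cong xs (λ _ → sym (length≡∑1 (functions d xs))) ⟩
  ∑[ x ∈ xs ] length (functions d xs)         ≡⟨ ∑-const xs _ ⟩
  length xs * length (functions d xs)         ≡⟨ cong (length xs *_) (length-functions d xs) ⟩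
  length xs * length xs ^ d                   ∎
  where open ≡-Reasoning

length-functions-suc : (d : ℕ) (xs : List A) →
  length (functions (suc d) xs) ≡ length xs * length (functions d xs)
length-functions-suc d xs = trans (length-functions (suc d) xs) (cong (length xs *_) (sym (length-functions d xs)))

functions-complete : (R : A → A → Set) {xs : List A} → (∀ a → Any (R a) xs) →
                     ∀ d (f : Vector A d) → Any (λ g → ∀ i → R (f i) (g i)) (functions d xs)
functions-complete R complete zero    f = here (λ ())
functions-complete R complete (suc d) f =
  cartesianProductWith⁺ Vector._∷_ (λ r rs → λ { zero → r ; (suc i) → rs i })
    (complete (f zero)) (functions-complete R complete d (f ∘ suc))

≤ᵇ-suc : ∀ m n → (suc m ≤ᵇ suc n) ≡ (m ≤ᵇ n)
≤ᵇ-suc zero    n = refl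
≤ᵇ-suc (suc m) n = refl

𝟙-suc-≤ᵇ-𝟙+ : ∀ b s h → 𝟙 (suc s ≤ᵇ 𝟙 b + h) ≤ 𝟙 b * 𝟙 (s ≤ᵇ h) + 𝟙 (suc s ≤ᵇ h)
𝟙-suc-≤ᵇ-𝟙+ true  s h = ≤-trans (≤-reflexive (trans (cong 𝟙 (≤ᵇ-suc s h)) (sym (*-identityˡ _)))) (m≤m+n _ _)
𝟙-suc-≤ᵇ-𝟙+ false s h = m≤n+m _ _

hits : ∀ {d} → (A → Bool) → Vector A d → ℕ
hits {d = d} p f = ∑[ i < d ] 𝟙 (p (f i))

module _ (q : ℕ) {xs : List A} (p : A → Bool) (sparse : count p xs * q ≤ length xs) where

  -- With N(d,s) the number of f having at least s hits, splitting off the first coordinate gives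
  -- N(d+1,s+1) ≤ count p xs · N(d,s) + length xs · N(d,s+1); the factor 2^d bounds the binomial
  -- coefficients that this recursion accumulates.
  count-hits-≥ : ∀ d s → count (λ f → s ≤ᵇ hits p f) (functions d xs) * q ^ s ≤ 2 ^ d * length xs ^ d
  count-hits-≥ d zero = begin
    count (λ _ → true) (functions d xs) * 1  ≡⟨ *-identityʳ _ ⟩
    ∑ˡ (functions d xs) (λ _ → 1)            ≡⟨ sym (length≡∑1 (functions d xs)) ⟩
    length (functions d xs)                  ≡⟨ length-functions d xs ⟩
    length xs ^ d                            ≤⟨ m≤n*m (length xs ^ d) (2 ^ d) {{m^n≢0 2 d}} ⟩
    2 ^ d * length xs ^ d                    ∎
    where open ≤-Reasoning
  count-hits-≥ zero    (suc s) = z≤n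
  count-hits-≥ (suc d) (suc s) = begin
    N (suc d) (suc s) * q ^ suc s
      ≡⟨ cong (_* q ^ suc s) (∑-cartesianProductWith Vector._∷_ xs (functions d xs) _) ⟩
    ∑[ x ∈ xs ] ∑[ t ∈ functions d xs ] 𝟙 (suc s ≤ᵇ 𝟙 (p x) + hits p t) * q ^ suc s
      ≤⟨ *-monoˡ-≤ (q ^ suc s) (∑-mono-≤ xs λ x → ∑-mono-≤ (functions d xs) λ t → 𝟙-suc-≤ᵇ-𝟙+ (p x) s (hits p t)) ⟩
    ∑[ x ∈ xs ] ∑[ t ∈ functions d xs ] (𝟙 (p x) * 𝟙 (s ≤ᵇ hits p t) + 𝟙 (suc s ≤ᵇ hits p t)) * q ^ suc s
      ≡⟨ cong (_* q ^ suc s) (∑-cong xs λ x → trans (∑-distrib-+ (functions d xs) _ _)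
           (cong (_+ N d (suc s)) (sym (*-distribˡ-∑ (functions d xs) (𝟙 (p x)) _)))) ⟩
    ∑[ x ∈ xs ] (𝟙 (p x) * N d s + N d (suc s)) * q ^ suc s
      ≡⟨ cong (_* q ^ suc s) (trans (∑-distrib-+ xs _ _)
           (cong₂ _+_ (sym (*-distribʳ-∑ xs (N d s) (𝟙 ∘ p))) (∑-const xs _))) ⟩
    (count p xs * N d s + length xs * N d (suc s)) * q ^ suc s
      ≡⟨ regroup (count p xs) (N d s) (length xs) (N d (suc s)) q (q ^ s) ⟩
    (count p xs * q) * (N d s * q ^ s) + length xs * (N d (suc s) * q ^ suc s)
      ≤⟨ +-mono-≤ (*-mono-≤ sparse (count-hits-≥ d s))
                  (*-monoʳ-≤ (length xs) (count-hits-≥ d (suc s))) ⟩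
    length xs * (2 ^ d * length xs ^ d) + length xs * (2 ^ d * length xs ^ d)
      ≡⟨ double (length xs) (2 ^ d) (length xs ^ d) ⟩
    2 ^ suc d * length xs ^ suc d ∎
    where
    open ≤-Reasoning
    N : ℕ → ℕ → ℕ
    N d s = count (λ f → s ≤ᵇ hits p f) (functions d xs)
    regroup : ∀ c a y b q′ r → (c * a + y * b) * (q′ * r) ≡ (c * q′) * (a * r) + y * (b * (q′ * r))
    regroup = solve-∀
    double : ∀ y t z → y * (t * z) + y * (t * z) ≡ (2 * t) * (y * z)
    double = solve-∀

module Collisions (q : ℕ) {{_ : NonZero q}} where

  _≈ᵇ_ : ℕ → ℕ → Bool
  a ≈ᵇ b = (a % q) ≡ᵇ (b % q)

  CollisionBound : (xs : List A) (w : A → C → ℕ) (Sep : C → C → Set) → Set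
  CollisionBound xs w Sep = ∀ K₁ K₂ u v → Sep u v →
    count (λ x → (K₁ + w x u) ≈ᵇ (K₂ + w x v)) xs * q ≤ length xs

  ∑weight : ∀ {d} → (A → C → ℕ) → Vector A d → Vector C d → ℕ
  ∑weight {d = d} w f u = ∑[ i < d ] w (f i) (u i)

  Somewhere : ∀ {d} → (C → C → Set) → Vector C d → Vector C d → Set
  Somewhere Sep u v = ∃ λ i → Sep (u i) (v i)

  -- Fixing all coordinates except one where the coefficients are separated leaves an instance of
  -- the hypothesis: the fixed coordinates are absorbed into the offsets K₁, K₂.
  collisionBound-functions : {xs : List A} {w : A → C → ℕ} {Sep : C → C → Set} → ∀ d →
    CollisionBound xs w Sep → CollisionBound (functions d xs) (∑weight w) (Somewhere Sep)
  collisionBound-functions {xs = xs} {w} {Sep} (suc d) bound K₁ K₂ u v (i , sep) = begin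
    ∑ˡ (functions (suc d) xs) collide * q
      ≡⟨ cong (_* q) (∑-cartesianProductWith Vector._∷_ xs (functions d xs) collide) ⟩
    ∑[ x ∈ xs ] ∑[ t ∈ functions d xs ] collide (x Vector.∷ t) * q
      ≤⟨ split i sep ⟩
    length xs * length (functions d xs)
      ≡⟨ sym (length-functions-suc d xs) ⟩
    length (functions (suc d) xs) ∎
    where
    open ≤-Reasoning
    collide : Vector _ (suc d) → ℕ
    collide f = 𝟙 ((K₁ + ∑weight w f u) ≈ᵇ (K₂ + ∑weight w f v))
    regroup : ∀ K a b → K + (a + b) ≡ K + b + a
    regroup = solve-∀
    split : ∀ i → Sep (u i) (v i) →
            ∑[ x ∈ xs ] ∑[ t ∈ functions d xs ] collide (x Vector.∷ t) * q ≤ length xs * length (functions d xs)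
    split zero sep = begin
      ∑[ x ∈ xs ] ∑[ t ∈ functions d xs ] collide (x Vector.∷ t) * q
        ≡⟨ cong (_* q) (∑-comm xs (functions d xs) _) ⟩
      ∑[ t ∈ functions d xs ] ∑[ x ∈ xs ] collide (x Vector.∷ t) * q
        ≡⟨ cong (_* q) (∑-cong (functions d xs) λ t → ∑-cong xs λ x → cong₂ (λ a b → 𝟙 (a ≈ᵇ b))
             (regroup K₁ (w x (u zero)) _) (regroup K₂ (w x (v zero)) _)) ⟩
      ∑[ t ∈ functions d xs ] count (λ x → (K₁ + ∑weight w t (u ∘ suc) + w x (u zero))
                                         ≈ᵇ (K₂ + ∑weight w t (v ∘ suc) + w x (v zero))) xs * q
        ≤⟨ ∑-bound (functions d xs) q (length xs) (λ t → bound _ _ _ _ sep) ⟩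
      length (functions d xs) * length xs
        ≡⟨ *-comm (length (functions d xs)) (length xs) ⟩
      length xs * length (functions d xs) ∎
    split (suc i) sep = begin
      ∑[ x ∈ xs ] ∑[ t ∈ functions d xs ] collide (x Vector.∷ t) * q
        ≡⟨ cong (_* q) (∑-cong xs λ x → ∑-cong (functions d xs) λ t → cong₂ (λ a b → 𝟙 (a ≈ᵇ b))
             (sym (+-assoc K₁ (w x (u zero)) _)) (sym (+-assoc K₂ (w x (v zero)) _))) ⟩
      ∑[ x ∈ xs ] count (λ t → (K₁ + w x (u zero) + ∑weight w t (u ∘ suc))
                             ≈ᵇ (K₂ + w x (v zero) + ∑weight w t (v ∘ suc))) (functions d xs) * q
        ≤⟨ ∑-bound xs q (length (functions d xs))
             (λ x → collisionBound-functions d bound _ _ (u ∘ suc) (v ∘ suc) (i , sep)) ⟩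
      length xs * length (functions d xs) ∎

module Modular (q : ℕ) {{_ : NonZero q}} where

  open Collisions q

  toℕ-mod : ∀ a → toℕ (a mod q) ≡ a % q
  toℕ-mod a = Finₚ.toℕ-fromℕ< (m%n<n a q)

  [m+n%q]%q≡[m+n]%q : ∀ m n → (m + n % q) % q ≡ (m + n) % q
  [m+n%q]%q≡[m+n]%q m n = begin
    (m + n % q) % q            ≡⟨ %-distribˡ-+ m (n % q) q ⟩
    (m % q + n % q % q) % q    ≡⟨ cong (λ z → (m % q + z) % q) (m%n%n≡m%n n q) ⟩
    (m % q + n % q) % q        ≡⟨ %-distribˡ-+ m n q ⟨
    (m + n) % q                ∎
    where open ≡-Reasoning

  [m*n%q]%q≡[m*n]%q : ∀ m n → (m * (n % q)) % q ≡ (m * n) % q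
  [m*n%q]%q≡[m*n]%q m n = begin
    (m * (n % q)) % q          ≡⟨ %-distribˡ-* m (n % q) q ⟩
    (m % q * (n % q % q)) % q  ≡⟨ cong (λ z → (m % q * z) % q) (m%n%n≡m%n n q) ⟩
    (m % q * (n % q)) % q      ≡⟨ %-distribˡ-* m n q ⟨
    (m * n) % q                ∎
    where open ≡-Reasoning

  ∑-%-cong : ∀ {d} (f g : Vector ℕ d) → (∀ i → f i % q ≡ g i % q) →
             (∑[ i < d ] f i) % q ≡ (∑[ i < d ] g i) % q
  ∑-%-cong {zero}  f g f≡g = refl
  ∑-%-cong {suc d} f g f≡g = begin
    (f zero + sum (f ∘ suc)) % q                 ≡⟨ %-distribˡ-+ (f zero) _ q ⟩
    (f zero % q + sum (f ∘ suc) % q) % q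
      ≡⟨ cong₂ (λ a b → (a + b) % q) (f≡g zero) (∑-%-cong (f ∘ suc) (g ∘ suc) (f≡g ∘ suc)) ⟩
    (g zero % q + sum (g ∘ suc) % q) % q         ≡⟨ %-distribˡ-+ (g zero) _ q ⟨
    (g zero + sum (g ∘ suc)) % q                 ∎
    where open ≡-Reasoning

  toℕ-sumF : ∀ d (f : Vector (𝔽 q) d) → toℕ (sumF d f) ≡ (∑[ i < d ] toℕ (f i)) % q
  toℕ-sumF zero    f = toℕ-mod 0
  toℕ-sumF (suc d) f = begin
    toℕ ((toℕ (f zero) + toℕ (sumF d (f ∘ suc))) mod q)   ≡⟨ toℕ-mod _ ⟩
    (toℕ (f zero) + toℕ (sumF d (f ∘ suc))) % q           ≡⟨ cong (λ z → (toℕ (f zero) + z) % q) (toℕ-sumF d (f ∘ suc)) ⟩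
    (toℕ (f zero) + sum (toℕ ∘ f ∘ suc) % q) % q          ≡⟨ [m+n%q]%q≡[m+n]%q (toℕ (f zero)) _ ⟩
    (toℕ (f zero) + sum (toℕ ∘ f ∘ suc)) % q              ∎
    where open ≡-Reasoning

  toℕ-dot : ∀ {d} (a b : Vector (𝔽 q) d) → toℕ (dot a b) ≡ (∑[ i < d ] (toℕ (a i) * toℕ (b i))) % q
  toℕ-dot {d} a b = trans (toℕ-sumF d (λ i → a i *F b i))
    (∑-%-cong (λ i → toℕ (a i *F b i)) (λ i → toℕ (a i) * toℕ (b i))
      (λ i → trans (cong (_% q) (toℕ-mod _)) (m%n%n≡m%n _ q)))

  entryWeight : 𝔽 q → ℕ → ℕ
  entryWeight x u = toℕ x * u

  outer : ∀ {k m} → Vector (𝔽 q) k → Vector (𝔽 q) m → Fin k → Fin m → ℕ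
  outer a b r c = toℕ (a r) * toℕ (b c)

  outer-congˡ : ∀ {k m} {a a′ : Vector (𝔽 q) k} (b : Vector (𝔽 q) m) →
                (∀ r → a r ≡ a′ r) → ∀ r c → outer a b r c ≡ outer a′ b r c
  outer-congˡ b a≡a′ r c = cong (λ x → toℕ x * toℕ (b c)) (a≡a′ r)

  matrixForm : ∀ {k m} → (Fin k → Fin m → 𝔽 q) → (Fin k → Fin m → ℕ) → ℕ
  matrixForm = ∑weight (∑weight entryWeight)

  toℕ-dot-matVec : ∀ {k m} (a : Vector (𝔽 q) k) (A : Fin k → Fin m → 𝔽 q) (b : Vector (𝔽 q) m) →
                   toℕ (dot a (matVec A b)) ≡ matrixForm A (outer a b) % q
  toℕ-dot-matVec {k} {m} a A b = begin
    toℕ (dot a (matVec A b))                        ≡⟨ toℕ-dot a (matVec A b) ⟩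
    (∑[ r < k ] (toℕ (a r) * toℕ (dot (A r) b))) % q  ≡⟨ ∑-%-cong _ _ reduce ⟩
    (∑[ r < k ] (toℕ (a r) * rowForm r)) % q          ≡⟨ cong (_% q) (sum-cong-≗ distribute) ⟩
    matrixForm A (outer a b) % q                    ∎
    where
    open ≡-Reasoning
    rowForm : Fin k → ℕ
    rowForm r = ∑[ c < m ] (toℕ (A r c) * toℕ (b c))
    reduce : ∀ r → (toℕ (a r) * toℕ (dot (A r) b)) % q ≡ (toℕ (a r) * rowForm r) % q
    reduce r = trans (cong (λ z → (toℕ (a r) * z) % q) (toℕ-dot (A r) b))
                     ([m*n%q]%q≡[m*n]%q (toℕ (a r)) (rowForm r))
    distribute : ∀ r → toℕ (a r) * rowForm r ≡ ∑weight entryWeight (A r) (outer a b r)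
    distribute r = trans (*-distribˡ-sum {n = m} (toℕ (a r)) (λ c → toℕ (A r c) * toℕ (b c)))
                         (sum-cong-≗ λ c → *-leftComm (toℕ (a r)) (toℕ (A r c)) (toℕ (b c)))


  ∣∸⇒%≡ : ∀ {a b} → b ≤ a → q ∣ a ∸ b → a % q ≡ b % q
  ∣∸⇒%≡ {a} {b} b≤a (dividesℕ j a∸b≡jq) = begin
    a % q                ≡⟨ cong (_% q) (m+[n∸m]≡n b≤a) ⟨
    (b + (a ∸ b)) % q    ≡⟨ cong (λ z → (b + z) % q) a∸b≡jq ⟩
    (b + j * q) % q      ≡⟨ [m+kn]%n≡m%n b j q ⟩
    b % q                ∎
    where open ≡-Reasoning

  ∣-⇒%≡ : ∀ a b → pos q ∣ℤ (pos a -ℤ pos b) → a % q ≡ b % q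
  ∣-⇒%≡ a b q∣a-b with ≤-total b a
  ... | inj₁ b≤a = ∣∸⇒%≡ b≤a (subst (q ∣_) (trans ∣a-b∣≡∣a⊖b∣ (trans (ℤₚ.∣m⊖n∣≡∣n⊖m∣ a b) (ℤₚ.∣⊖∣-≤ b≤a))) (∣⇒∣ᵤ q∣a-b))
    where
    ∣a-b∣≡∣a⊖b∣ : ∣ pos a -ℤ pos b ∣ ≡ ∣ a ⊖ b ∣
    ∣a-b∣≡∣a⊖b∣ = cong ∣_∣ (ℤₚ.m-n≡m⊖n a b)
  ... | inj₂ a≤b = sym (∣∸⇒%≡ a≤b (subst (q ∣_) (trans ∣a-b∣≡∣a⊖b∣ (ℤₚ.∣⊖∣-≤ a≤b)) (∣⇒∣ᵤ q∣a-b)))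
    where
    ∣a-b∣≡∣a⊖b∣ : ∣ pos a -ℤ pos b ∣ ≡ ∣ a ⊖ b ∣
    ∣a-b∣≡∣a⊖b∣ = cong ∣_∣ (ℤₚ.m-n≡m⊖n a b)

  %≡⇒∣- : ∀ a b → a % q ≡ b % q → pos q ∣ℤ (pos a -ℤ pos b)
  %≡⇒∣- a b a≡b = divides (pos (a / q) -ℤ pos (b / q)) (begin
    pos a -ℤ pos b
      ≡⟨ cong₂ _-ℤ_ (split a) (trans (split b) (cong (λ r → pos r +ℤ pos (b / q) *ℤ pos q) (sym a≡b))) ⟩
    (pos (a % q) +ℤ pos (a / q) *ℤ pos q) -ℤ (pos (a % q) +ℤ pos (b / q) *ℤ pos q)
      ≡⟨ cancel (pos (a % q)) (pos (a / q)) (pos (b / q)) (pos q) ⟩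
    (pos (a / q) -ℤ pos (b / q)) *ℤ pos q ∎)
    where
    open ≡-Reasoning
    split : ∀ n → pos n ≡ pos (n % q) +ℤ pos (n / q) *ℤ pos q
    split n = trans (cong pos (m≡m%n+[m/n]*n n q))
                    (trans (ℤₚ.pos-+ (n % q) _) (cong (pos (n % q) +ℤ_) (ℤₚ.pos-* (n / q) q)))
    cancel : ∀ r x y z → (r +ℤ x *ℤ z) -ℤ (r +ℤ y *ℤ z) ≡ (x -ℤ y) *ℤ z
    cancel = ℤ-Solver.solve-∀

  T-≈ᵇ⇒%≡ : ∀ {a b} → T (a ≈ᵇ b) → a % q ≡ b % q
  T-≈ᵇ⇒%≡ {a} {b} = ≡ᵇ⇒≡ (a % q) (b % q)

  %≡⇒T-≈ᵇ : ∀ {a b} → a % q ≡ b % q → T (a ≈ᵇ b)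
  %≡⇒T-≈ᵇ {a} {b} = ≡⇒≡ᵇ (a % q) (b % q)

  collisions⇒∣[x-y]*[u-v] : ∀ K₁ K₂ u v x y →
    (K₁ + x * u) % q ≡ (K₂ + x * v) % q → (K₁ + y * u) % q ≡ (K₂ + y * v) % q →
    q ∣ ∣ pos x -ℤ pos y ∣ * ∣ pos u -ℤ pos v ∣
  collisions⇒∣[x-y]*[u-v] K₁ K₂ u v x y x-collides y-collides =
    subst (q ∣_) (ℤₚ.abs-* (pos x -ℤ pos y) (pos u -ℤ pos v)) (∣⇒∣ᵤ (subst (pos q ∣ℤ_) difference≡
      (∣m∣n⇒∣m-n (%≡⇒∣- _ _ x-collides) (%≡⇒∣- _ _ y-collides))))
    where
    pos-affine : ∀ a b c → pos (a + b * c) ≡ pos a +ℤ pos b *ℤ pos c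
    pos-affine a b c = trans (ℤₚ.pos-+ a _) (cong (pos a +ℤ_) (ℤₚ.pos-* b c))
    difference : ∀ k₁ k₂ x y u v →
      ((k₁ +ℤ x *ℤ u) -ℤ (k₂ +ℤ x *ℤ v)) -ℤ ((k₁ +ℤ y *ℤ u) -ℤ (k₂ +ℤ y *ℤ v)) ≡ (x -ℤ y) *ℤ (u -ℤ v)
    difference = ℤ-Solver.solve-∀
    difference≡ : (pos (K₁ + x * u) -ℤ pos (K₂ + x * v)) -ℤ (pos (K₁ + y * u) -ℤ pos (K₂ + y * v))
                  ≡ (pos x -ℤ pos y) *ℤ (pos u -ℤ pos v)
    difference≡ = trans (cong₂ _-ℤ_ (cong₂ _-ℤ_ (pos-affine K₁ x u) (pos-affine K₂ x v))
                                    (cong₂ _-ℤ_ (pos-affine K₁ y u) (pos-affine K₂ y v)))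
                        (difference (pos K₁) (pos K₂) (pos x) (pos y) (pos u) (pos v))

  module _ (prime : Prime q) where

    collision-unique : ∀ K₁ K₂ u v → u % q ≢ v % q → (x y : 𝔽 q) →
      (K₁ + toℕ x * u) % q ≡ (K₂ + toℕ x * v) % q →
      (K₁ + toℕ y * u) % q ≡ (K₂ + toℕ y * v) % q → x ≡ y
    collision-unique K₁ K₂ u v u≢v x y x-collides y-collides =
      [ x≡y , (λ q∣u-v → ⊥-elim (u≢v (∣-⇒%≡ u v (∣ᵤ⇒∣ q∣u-v)))) ]′
        (euclidsLemma _ _ prime (collisions⇒∣[x-y]*[u-v] K₁ K₂ u v (toℕ x) (toℕ y) x-collides y-collides))
      where
      x≡y : q ∣ ∣ pos (toℕ x) -ℤ pos (toℕ y) ∣ → x ≡ y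
      x≡y q∣x-y = Finₚ.toℕ-injective (begin
        toℕ x      ≡⟨ m<n⇒m%n≡m (Finₚ.toℕ<n x) ⟨
        toℕ x % q  ≡⟨ ∣-⇒%≡ (toℕ x) (toℕ y) (∣ᵤ⇒∣ q∣x-y) ⟩
        toℕ y % q  ≡⟨ m<n⇒m%n≡m (Finₚ.toℕ<n y) ⟩
        toℕ y      ∎)
        where open ≡-Reasoning

    collisionBound-entries : CollisionBound (allFin q) entryWeight (λ u v → u % q ≢ v % q)
    collisionBound-entries K₁ K₂ u v u≢v = begin
      count (λ x → (K₁ + entryWeight x u) ≈ᵇ (K₂ + entryWeight x v)) (allFin q) * q
        ≤⟨ *-monoˡ-≤ q (count-tabulate-≤1 id _
             λ x y x-collides y-collides →
               collision-unique K₁ K₂ u v u≢v x y (T-≈ᵇ⇒%≡ x-collides) (T-≈ᵇ⇒%≡ y-collides)) ⟩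
      1 * q          ≡⟨ *-identityˡ q ⟩
      q              ≡⟨ length-allFin q ⟨
      length (allFin q) ∎
      where open ≤-Reasoning

  toℕ-0F : toℕ (0F {q}) ≡ 0
  toℕ-0F = trans (toℕ-mod 0) (m<n⇒m%n≡m (>-nonZero⁻¹ q))

  neg : 𝔽 q → 𝔽 q
  neg β = (q ∸ toℕ β) mod q

  +-neg-%≡0 : ∀ β → (toℕ β + toℕ (neg β)) % q ≡ 0
  +-neg-%≡0 β = begin
    (toℕ β + toℕ ((q ∸ toℕ β) mod q)) % q  ≡⟨ cong (λ z → (toℕ β + z) % q) (toℕ-mod _) ⟩
    (toℕ β + (q ∸ toℕ β) % q) % q          ≡⟨ [m+n%q]%q≡[m+n]%q (toℕ β) _ ⟩
    (toℕ β + (q ∸ toℕ β)) % q              ≡⟨ cong (_% q) (m+[n∸m]≡n (<⇒≤ (Finₚ.toℕ<n β))) ⟩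
    q % q                                  ≡⟨ n%n≡0 q ⟩
    0                                      ∎
    where open ≡-Reasoning

  neg≡0F⇒≡0F : ∀ β → neg β ≡ 0F → β ≡ 0F
  neg≡0F⇒≡0F β negβ≡0 = Finₚ.toℕ-injective (begin
    toℕ β                       ≡⟨ m<n⇒m%n≡m (Finₚ.toℕ<n β) ⟨
    toℕ β % q                   ≡⟨ cong (_% q) (+-identityʳ (toℕ β)) ⟨
    (toℕ β + 0) % q             ≡⟨ cong (λ z → (toℕ β + z) % q) (trans (cong toℕ negβ≡0) toℕ-0F) ⟨
    (toℕ β + toℕ (neg β)) % q   ≡⟨ trans (+-neg-%≡0 β) (sym toℕ-0F) ⟩
    toℕ (0F {q})                ∎)
    where open ≡-Reasoning

  lin2-neg≡0F : ∀ {k} (a₁ a₂ : Vector (𝔽 q) k) (β₁ β₂ : 𝔽 q) →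
    (∀ r → (toℕ (a₁ r) * toℕ β₁) % q ≡ (toℕ (a₂ r) * toℕ β₂) % q) →
    ∀ r → lin2 β₁ a₁ (neg β₂) a₂ r ≡ 0F
  lin2-neg≡0F a₁ a₂ β₁ β₂ proportional r = Finₚ.toℕ-injective (begin
    toℕ (lin2 β₁ a₁ (neg β₂) a₂ r)                        ≡⟨ toℕ-mod _ ⟩
    (toℕ (β₁ *F a₁ r) + toℕ (neg β₂ *F a₂ r)) % q         ≡⟨ cong₂ (λ x y → (x + y) % q) (toℕ-mod _) (toℕ-mod _) ⟩
    ((β₁′ * α₁) % q + (nβ₂ * α₂) % q) % q                 ≡⟨ cong (λ x → (x % q + (nβ₂ * α₂) % q) % q) (*-comm β₁′ α₁) ⟩
    ((α₁ * β₁′) % q + (nβ₂ * α₂) % q) % q                 ≡⟨ cong (λ x → (x + (nβ₂ * α₂) % q) % q) (proportional r) ⟩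
    ((α₂ * β₂′) % q + (nβ₂ * α₂) % q) % q                 ≡⟨ %-distribˡ-+ (α₂ * β₂′) _ q ⟨
    (α₂ * β₂′ + nβ₂ * α₂) % q                             ≡⟨ cong (λ x → (α₂ * β₂′ + x) % q) (*-comm nβ₂ α₂) ⟩
    (α₂ * β₂′ + α₂ * nβ₂) % q                             ≡⟨ cong (_% q) (*-distribˡ-+ α₂ β₂′ nβ₂) ⟨
    (α₂ * (β₂′ + nβ₂)) % q                                ≡⟨ [m*n%q]%q≡[m*n]%q α₂ _ ⟨
    (α₂ * ((β₂′ + nβ₂) % q)) % q                          ≡⟨ cong (λ z → (α₂ * z) % q) (+-neg-%≡0 β₂) ⟩
    (α₂ * 0) % q                                          ≡⟨ cong (_% q) (*-zeroʳ α₂) ⟩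
    0 % q                                                 ≡⟨ toℕ-mod 0 ⟨
    toℕ (0F {q})                                          ∎)
    where
    open ≡-Reasoning
    α₁ α₂ β₁′ β₂′ nβ₂ : ℕ
    α₁ = toℕ (a₁ r)
    α₂ = toℕ (a₂ r)
    β₁′ = toℕ β₁
    β₂′ = toℕ β₂
    nβ₂ = toℕ (neg β₂)

  -- At a coordinate c with b₁ c ≠ b₂ c, proportionality would make (b₁ c)·a₁ − (b₂ c)·a₂ vanish.
  outer-not-proportional : ∀ {k m} (a₁ a₂ : Vector (𝔽 q) k) (b₁ b₂ : Vector (𝔽 q) m) →
    ¬ (b₁ ≈v b₂) → LinIndep2 a₁ a₂ → ¬ (∀ r c → outer a₁ b₁ r c % q ≡ outer a₂ b₂ r c % q)
  outer-not-proportional {m = m} a₁ a₂ b₁ b₂ b₁≉b₂ independent proportional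
    with c , b₁c≢b₂c ← Finₚ.¬∀⟶∃¬ m _ (λ c → b₁ c Finₚ.≟ b₂ c) b₁≉b₂
    with β₁≡0 , negβ₂≡0 ← independent (b₁ c) (neg (b₂ c))
                            (lin2-neg≡0F a₁ a₂ (b₁ c) (b₂ c) (λ r → proportional r c))
    = b₁c≢b₂c (trans β₁≡0 (sym (neg≡0F⇒≡0F (b₂ c) negβ₂≡0)))

  outer-separated : ∀ {k m} (a₁ a₂ : Vector (𝔽 q) k) (b₁ b₂ : Vector (𝔽 q) m) →
    ¬ (b₁ ≈v b₂) → LinIndep2 a₁ a₂ →
    Somewhere (Somewhere (λ u v → u % q ≢ v % q)) (outer a₁ b₁) (outer a₂ b₂)
  outer-separated {k} {m} a₁ a₂ b₁ b₂ b₁≉b₂ independent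
    with r , ¬all ← Finₚ.¬∀⟶∃¬ k _ (λ r → Finₚ.all? (λ c → _ ℕ≟ _))
                      (outer-not-proportional a₁ a₂ b₁ b₂ b₁≉b₂ independent)
    = r , Finₚ.¬∀⟶∃¬ m _ (λ c → _ ℕ≟ _) ¬all

hamming-+-agreements : ∀ {q t} (x y : Vector (𝔽 q) t) (p : Vector Bool t) →
  (∀ i → T (p i) → x i ≡ y i) → (∀ i → x i ≡ y i → T (p i)) →
  hamming x y + ∑[ i < t ] 𝟙 (p i) ≡ t
hamming-+-agreements {t = zero}  x y p sound complete = refl
hamming-+-agreements {t = suc t} x y p sound complete with x zero Finₚ.≟ y zero
... | yes x₀≡y₀ with p zero | complete zero x₀≡y₀
...   | true | _ = trans (+-suc _ _)
  (cong suc (hamming-+-agreements (x ∘ suc) (y ∘ suc) (p ∘ suc) (sound ∘ suc) (complete ∘ suc)))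
hamming-+-agreements {t = suc t} x y p sound complete | no x₀≢y₀ with p zero in p₀
... | true  = ⊥-elim (x₀≢y₀ (sound zero (subst T (sym p₀) tt)))
... | false = cong suc (hamming-+-agreements (x ∘ suc) (y ∘ suc) (p ∘ suc) (sound ∘ suc) (complete ∘ suc))

majority : ℕ → ℕ
majority t = suc ⌊ t /2⌋

⌊n/2⌋+⌊n/2⌋≤n : ∀ n → ⌊ n /2⌋ + ⌊ n /2⌋ ≤ n
⌊n/2⌋+⌊n/2⌋≤n n = ≤-trans (+-monoʳ-≤ ⌊ n /2⌋ (⌊n/2⌋≤⌈n/2⌉ n)) (≤-reflexive (⌊n/2⌋+⌈n/2⌉≡n n))

n≤2*majority : ∀ n → n ≤ 2 * majority n
n≤2*majority n = begin
  n                            ≡⟨ ⌊n/2⌋+⌈n/2⌉≡n n ⟨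
  ⌊ n /2⌋ + ⌈ n /2⌉            ≤⟨ +-monoʳ-≤ ⌊ n /2⌋ (⌊n/2⌋-mono (n≤1+n (suc n))) ⟩
  ⌊ n /2⌋ + majority n         ≤⟨ +-monoˡ-≤ (majority n) (n≤1+n ⌊ n /2⌋) ⟩
  majority n + majority n      ≡⟨ cong (majority n +_) (+-identityʳ (majority n)) ⟨
  2 * majority n               ∎
  where open ≤-Reasoning

majority-≤ : ∀ {t h a} → h + a ≡ t → ¬ (t ≤ 2 * h) → majority t ≤ a
majority-≤ {t} {h} {a} h+a≡t t≰2h = *-cancelˡ-< 2 ⌊ t /2⌋ a (begin-strict
  2 * ⌊ t /2⌋       ≡⟨ cong (⌊ t /2⌋ +_) (+-identityʳ ⌊ t /2⌋) ⟩
  ⌊ t /2⌋ + ⌊ t /2⌋ ≤⟨ ⌊n/2⌋+⌊n/2⌋≤n t ⟩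
  t                 ≡⟨ h+a≡t ⟨
  h + a             <⟨ +-monoˡ-< a h<a ⟩
  a + a             ≡⟨ cong (a +_) (+-identityʳ a) ⟨
  2 * a             ∎)
  where
  open ≤-Reasoning
  h<a : h < a
  h<a = +-cancelˡ-< h h a (begin-strict
    h + h      ≡⟨ cong (h +_) (+-identityʳ h) ⟨
    2 * h      <⟨ ≰⇒> t≰2h ⟩
    t          ≡⟨ h+a≡t ⟨
    h + a      ∎)

^-distribʳ-* : ∀ a b e → (a * b) ^ e ≡ a ^ e * b ^ e
^-distribʳ-* a b zero    = refl
^-distribʳ-* a b (suc e) = trans (cong (a * b *_) (^-distribʳ-* a b e)) ([m*n]*[o*p]≡[m*o]*[n*p] a b (a ^ e) (b ^ e))

^-cancelʳ-≤ : ∀ e .{{_ : NonZero e}} {x y} → x ^ e ≤ y ^ e → x ≤ y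
^-cancelʳ-≤ e {x} {y} xᵉ≤yᵉ with ≤-<-connex x y
... | inj₁ x≤y = x≤y
... | inj₂ y<x = contradiction xᵉ≤yᵉ (<⇒≱ (^-monoˡ-< e y<x))

m⁵*n≤m⁴*o⇒m*n≤o : ∀ m {n o} → m ^ 5 * n ≤ m ^ 4 * o → m * n ≤ o
m⁵*n≤m⁴*o⇒m*n≤o zero          _ = z≤n
m⁵*n≤m⁴*o⇒m*n≤o m@(suc _) {n} {o} m⁵n≤m⁴o =
  *-cancelˡ-≤ (m ^ 4) {{m^n≢0 m 4}} (subst (_≤ m ^ 4 * o) m⁵n≡m⁴[mn] m⁵n≤m⁴o)
  where
  m⁵n≡m⁴[mn] : m ^ 5 * n ≡ m ^ 4 * (m * n)
  m⁵n≡m⁴[mn] = trans (cong (_* n) (*-comm m (m ^ 4))) (*-assoc (m ^ 4) m n)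

n⁵*2ˡ≤q^majority : ∀ {q n ℓ} → 2 ^ 12 ≤ q → n ^ 12 ≤ q ^ ℓ → n ^ 5 * 2 ^ ℓ ≤ q ^ majority ℓ
n⁵*2ˡ≤q^majority {q} {n} {ℓ} 2¹²≤q n¹²≤qˡ = ^-cancelʳ-≤ 12 (begin
  (n ^ 5 * 2 ^ ℓ) ^ 12         ≡⟨ ^-distribʳ-* (n ^ 5) (2 ^ ℓ) 12 ⟩
  (n ^ 5) ^ 12 * (2 ^ ℓ) ^ 12  ≡⟨ cong₂ _*_ (swap-exponents n 5 12) (swap-exponents 2 ℓ 12) ⟩
  (n ^ 12) ^ 5 * (2 ^ 12) ^ ℓ  ≤⟨ *-mono-≤ (^-monoˡ-≤ 5 n¹²≤qˡ) (^-monoˡ-≤ ℓ 2¹²≤q) ⟩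
  (q ^ ℓ) ^ 5 * q ^ ℓ          ≡⟨ cong (_* q ^ ℓ) (^-*-assoc q ℓ 5) ⟩
  q ^ (ℓ * 5) * q ^ ℓ          ≡⟨ ^-distribˡ-+-* q (ℓ * 5) ℓ ⟨
  q ^ (ℓ * 5 + ℓ)              ≤⟨ ^-monoʳ-≤ q {{q≢0}} exponent≤ ⟩
  q ^ (majority ℓ * 12)        ≡⟨ ^-*-assoc q (majority ℓ) 12 ⟨
  (q ^ majority ℓ) ^ 12        ∎)
  where
  open ≤-Reasoning
  swap-exponents : ∀ a b c → (a ^ b) ^ c ≡ (a ^ c) ^ b
  swap-exponents a b c = trans (^-*-assoc a b c) (trans (cong (a ^_) (*-comm b c)) (sym (^-*-assoc a c b)))
  q≢0 : NonZero q
  q≢0 = >-nonZero (≤-trans (m^n>0 2 12) 2¹²≤q)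
  exponent≤ : ℓ * 5 + ℓ ≤ majority ℓ * 12
  exponent≤ = begin
    ℓ * 5 + ℓ               ≡⟨ six ℓ ⟩
    6 * ℓ                   ≤⟨ *-monoʳ-≤ 6 (n≤2*majority ℓ) ⟩
    6 * (2 * majority ℓ)    ≡⟨ twelve (majority ℓ) ⟩
    majority ℓ * 12         ∎
    where
    six : ∀ l → l * 5 + l ≡ 6 * l
    six = solve-∀
    twelve : ∀ s → 6 * (2 * s) ≡ s * 12
    twelve = solve-∀

module BadChoices (q : ℕ) {{_ : NonZero q}} (prime : Prime q) (k m ℓ n : ℕ) (B : Fin n → Fin m → 𝔽 q) where

  open Collisions q
  open Modular q

  Matrix : Set
  Matrix = Fin k → Fin m → 𝔽 q

  Coefficients : Set
  Coefficients = Fin k → Fin m → ℕ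

  Term : Set
  Term = 𝔽 q × Fin n

  Config : Set
  Config = ((Term × Term) × (Term × Term)) × (Vector (𝔽 q) k × Vector (𝔽 q) k)

  combination : Term × Term → Vector (𝔽 q) m
  combination ((γ₁ , i₁) , (γ₂ , i₂)) = lin2 γ₁ (B i₁) γ₂ (B i₂)

  coefficients₁ coefficients₂ : Config → Coefficients
  coefficients₁ ((c₁ , c₂) , (a₁ , a₂)) = outer a₁ (combination c₁)
  coefficients₂ ((c₁ , c₂) , (a₁ , a₂)) = outer a₂ (combination c₂)

  terms : List Term
  terms = cartesianProduct (allFin q) (allFin n)

  vectors : List (Vector (𝔽 q) k)
  vectors = functions k (allFin q)

  combinations : List ((Term × Term) × (Term × Term))
  combinations = cartesianProduct (cartesianProduct terms terms) (cartesianProduct terms terms)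

  configs : List Config
  configs = cartesianProduct combinations (cartesianProduct vectors vectors)

  matrices : List Matrix
  matrices = functions k (functions m (allFin q))

  collides : Coefficients → Coefficients → Matrix → Bool
  collides U V A = matrixForm A U ≈ᵇ matrixForm A V

  manyCollisions : Coefficients → Coefficients → Vector Matrix ℓ → Bool
  manyCollisions U V As = majority ℓ ≤ᵇ hits (collides U V) As

  Separated : Coefficients → Coefficients → Set
  Separated = Somewhere (Somewhere (λ u v → u % q ≢ v % q))

  separated? : ∀ U V → Dec (Separated U V)
  separated? U V = Finₚ.any? λ r → Finₚ.any? λ c → ¬? (U r c % q ℕ≟ V r c % q)

  -- Only separated configurations arise from the event (outer-separated), so the others contribute
  -- no bad choices.
  badMatrices : Config → List (Vector Matrix ℓ)
  badMatrices τ with separated? (coefficients₁ τ) (coefficients₂ τ)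
  ... | yes _ = filterᵇ (manyCollisions (coefficients₁ τ) (coefficients₂ τ)) (functions ℓ matrices)
  ... | no  _ = []

  L : List (Vector Matrix ℓ)
  L = concatMap badMatrices configs

  collisionBound-matrices : CollisionBound matrices matrixForm Separated
  collisionBound-matrices = collisionBound-functions k (collisionBound-functions m (collisionBound-entries prime))

  module _ (q-large : 2 ^ (12 * k) < q) (n¹²≤qˡ : n ^ 12 ≤ q ^ ℓ) where

    badMatrices-bound : ∀ τ → n ^ 5 * length (badMatrices τ) ≤ length matrices ^ ℓ
    badMatrices-bound τ with separated? (coefficients₁ τ) (coefficients₂ τ)
    ... | no  _ = ≤-trans (≤-reflexive (*-zeroʳ (n ^ 5))) z≤n
    ... | yes separated@(r , _) = *-cancelʳ-≤ _ _ (q ^ majority ℓ) {{m^n≢0 q (majority ℓ)}} (begin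
      n ^ 5 * length (filterᵇ many (functions ℓ matrices)) * q ^ majority ℓ
        ≡⟨ trans (*-assoc (n ^ 5) _ _)
                 (cong (λ c → n ^ 5 * (c * q ^ majority ℓ)) (length-filterᵇ many (functions ℓ matrices))) ⟩
      n ^ 5 * (count many (functions ℓ matrices) * q ^ majority ℓ)
        ≤⟨ *-monoʳ-≤ (n ^ 5)
             (count-hits-≥ q (collides U V) (collisionBound-matrices 0 0 U V separated) ℓ (majority ℓ)) ⟩
      n ^ 5 * (2 ^ ℓ * length matrices ^ ℓ)
        ≡⟨ *-assoc (n ^ 5) (2 ^ ℓ) _ ⟨
      n ^ 5 * 2 ^ ℓ * length matrices ^ ℓ
        ≤⟨ *-monoˡ-≤ (length matrices ^ ℓ) (n⁵*2ˡ≤q^majority {q} {n} {ℓ} 2¹²≤q n¹²≤qˡ) ⟩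
      q ^ majority ℓ * length matrices ^ ℓ
        ≡⟨ *-comm (q ^ majority ℓ) _ ⟩
      length matrices ^ ℓ * q ^ majority ℓ ∎)
      where
      open ≤-Reasoning
      U V : Coefficients
      U = coefficients₁ τ
      V = coefficients₂ τ
      many : Vector Matrix ℓ → Bool
      many = manyCollisions U V
      2¹²≤q : 2 ^ 12 ≤ q
      2¹²≤q = ≤-trans (^-monoʳ-≤ 2 (*-monoʳ-≤ 12 {1} (≤-trans (s≤s z≤n) (Finₚ.toℕ<n r)))) (<⇒≤ q-large)

    n⁵*length-L≤ : n ^ 5 * length L ≤ length configs * length matrices ^ ℓ
    n⁵*length-L≤ = begin
      n ^ 5 * length L                                   ≡⟨ cong (n ^ 5 *_) (length-concatMap badMatrices configs) ⟩
      n ^ 5 * ∑[ τ ∈ configs ] length (badMatrices τ)    ≡⟨ *-distribˡ-∑ configs (n ^ 5) _ ⟩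
      ∑[ τ ∈ configs ] (n ^ 5 * length (badMatrices τ))  ≤⟨ ∑-mono-≤ configs badMatrices-bound ⟩
      ∑[ τ ∈ configs ] (length matrices ^ ℓ)             ≡⟨ ∑-const configs _ ⟩
      length configs * length matrices ^ ℓ               ∎
      where open ≤-Reasoning

  length-terms : length terms ≡ q * n
  length-terms = trans (length-cartesianProduct (allFin q) (allFin n)) (cong₂ _*_ (length-allFin q) (length-allFin n))

  length-vectors : length vectors ≡ q ^ k
  length-vectors = trans (length-functions k (allFin q)) (cong (_^ k) (length-allFin q))

  length-configs : length configs ≡ n ^ 4 * q ^ (4 + k + k)
  length-configs = begin
    length configs
      ≡⟨ trans (length-cartesianProduct combinations (cartesianProduct vectors vectors)) (cong₂ _*_
           (trans (length-cartesianProduct pairs pairs) (cong₂ _*_ length-pairs length-pairs))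
           (trans (length-cartesianProduct vectors vectors) (cong₂ _*_ length-vectors length-vectors))) ⟩
    (q * n * (q * n)) * (q * n * (q * n)) * (q ^ k * q ^ k)
      ≡⟨ rearrange q n (q ^ k) ⟩
    n ^ 4 * (q ^ 4 * q ^ k * q ^ k)
      ≡⟨ cong (n ^ 4 *_) (trans (^-distribˡ-+-* q (4 + k) k) (cong (_* q ^ k) (^-distribˡ-+-* q 4 k))) ⟨
    n ^ 4 * q ^ (4 + k + k) ∎
    where
    open ≡-Reasoning
    pairs : List (Term × Term)
    pairs = cartesianProduct terms terms
    length-pairs : length pairs ≡ q * n * (q * n)
    length-pairs = trans (length-cartesianProduct terms terms) (cong₂ _*_ length-terms length-terms)
    rearrange : ∀ q n Q → (q * n * (q * n)) * (q * n * (q * n)) * (Q * Q)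
                          ≡ n * (n * (n * (n * 1))) * (q * (q * (q * (q * 1))) * Q * Q)
    rearrange = solve-∀

  length-matrices^ℓ : length matrices ^ ℓ ≡ q ^ (ℓ * k * m)
  length-matrices^ℓ = begin
    length matrices ^ ℓ         ≡⟨ cong (_^ ℓ) (trans (length-functions k _) (cong (_^ k) length-rows)) ⟩
    ((q ^ m) ^ k) ^ ℓ           ≡⟨ trans (cong (_^ ℓ) (^-*-assoc q m k)) (^-*-assoc q (m * k) ℓ) ⟩
    q ^ (m * k * ℓ)             ≡⟨ cong (q ^_) (reverse m k ℓ) ⟩
    q ^ (ℓ * k * m)             ∎
    where
    open ≡-Reasoning
    length-rows : length (functions m (allFin q)) ≡ q ^ m
    length-rows = trans (length-functions m _) (cong (_^ m) (length-allFin q))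
    reverse : ∀ m k ℓ → m * k * ℓ ≡ ℓ * k * m
    reverse = solve-∀

  matrixForm-cong : ∀ {A A′ : Matrix} {U U′ : Coefficients} →
    (∀ r c → A r c ≡ A′ r c) → (∀ r c → U r c ≡ U′ r c) → matrixForm A U ≡ matrixForm A′ U′
  matrixForm-cong A≡A′ U≡U′ = sum-cong-≗ λ r → sum-cong-≗ λ c → cong₂ entryWeight (A≡A′ r c) (U≡U′ r c)

  manyCollisions-cong : ∀ {U U′ V V′ : Coefficients} {As As′ : Vector Matrix ℓ} →
    (∀ r c → U r c ≡ U′ r c) → (∀ r c → V r c ≡ V′ r c) → PointwiseEq3 As As′ →
    manyCollisions U V As ≡ manyCollisions U′ V′ As′
  manyCollisions-cong U≡U′ V≡V′ As≡As′ = cong (majority ℓ ≤ᵇ_) (sum-cong-≗ λ i → cong 𝟙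
    (cong₂ _≈ᵇ_ (matrixForm-cong (As≡As′ i) U≡U′) (matrixForm-cong (As≡As′ i) V≡V′)))

  separated-cong : ∀ {U U′ V V′ : Coefficients} →
    (∀ r c → U r c ≡ U′ r c) → (∀ r c → V r c ≡ V′ r c) → Separated U V → Separated U′ V′
  separated-cong U≡U′ V≡V′ (r , c , separated) =
    r , c , subst₂ (λ u v → u % q ≢ v % q) (U≡U′ r c) (V≡V′ r c) separated

  close⇒manyCollisions : ∀ (As : Vector Matrix ℓ) a₁ a₂ b₁ b₂ →
    ¬ RelDistAtLeastHalf (𝓜 a₁ (g As b₁)) (𝓜 a₂ (g As b₂)) →
    T (manyCollisions (outer a₁ b₁) (outer a₂ b₂) As)
  close⇒manyCollisions As a₁ a₂ b₁ b₂ close =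
    ≤⇒≤ᵇ (majority-≤ {a = hits (collides U V) As}
      (hamming-+-agreements (𝓜 a₁ (g As b₁)) (𝓜 a₂ (g As b₂)) (collides U V ∘ As) sound complete) close)
    where
    U V : Coefficients
    U = outer a₁ b₁
    V = outer a₂ b₂
    sound : ∀ i → T (collides U V (As i)) → dot a₁ (matVec (As i) b₁) ≡ dot a₂ (matVec (As i) b₂)
    sound i collision = Finₚ.toℕ-injective (trans (toℕ-dot-matVec a₁ (As i) b₁)
      (trans (T-≈ᵇ⇒%≡ collision) (sym (toℕ-dot-matVec a₂ (As i) b₂))))
    complete : ∀ i → dot a₁ (matVec (As i) b₁) ≡ dot a₂ (matVec (As i) b₂) → T (collides U V (As i))
    complete i equal = %≡⇒T-≈ᵇ (trans (sym (toℕ-dot-matVec a₁ (As i) b₁))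
      (trans (cong toℕ equal) (toℕ-dot-matVec a₂ (As i) b₂)))

  ∈-vectors : ∀ a → Any (λ a′ → ∀ r → a r ≡ a′ r) vectors
  ∈-vectors = functions-complete _≡_ ∈-allFin k

  ∈-matrices : ∀ A → Any (λ A′ → ∀ r c → A r c ≡ A′ r c) matrices
  ∈-matrices = functions-complete (λ row row′ → ∀ c → row c ≡ row′ c) (functions-complete _≡_ ∈-allFin m) k

  ∈-terms : ∀ t → Any (t ≡_) terms
  ∈-terms (γ , i) = ∈-cartesianProduct⁺ (∈-allFin γ) (∈-allFin i)

  ∈-combinations : ∀ (c₁ c₂ : Term × Term) → Any ((c₁ , c₂) ≡_) combinations
  ∈-combinations (t₁ , t₂) (t₃ , t₄) =
    ∈-cartesianProduct⁺ (∈-cartesianProduct⁺ (∈-terms t₁) (∈-terms t₂)) (∈-cartesianProduct⁺ (∈-terms t₃) (∈-terms t₄))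

  badMatrices-complete : ∀ τ {U V} (As : Vector Matrix ℓ) →
    (∀ r c → U r c ≡ coefficients₁ τ r c) → (∀ r c → V r c ≡ coefficients₂ τ r c) →
    Separated U V → T (manyCollisions U V As) → Any (PointwiseEq3 As) (badMatrices τ)
  badMatrices-complete τ As U≡ V≡ separated many with separated? (coefficients₁ τ) (coefficients₂ τ)
  ... | no not-separated = ⊥-elim (not-separated (separated-cong U≡ V≡ separated))
  ... | yes _ = filterᵇ⁺ _ (Any.map (λ As≡As′ → As≡As′ , subst T (manyCollisions-cong U≡ V≡ As≡As′) many)
                                    (functions-complete _ ∈-matrices ℓ As))

  L-complete : ∀ (As : Vector Matrix ℓ) c₁ c₂ a₁ a₂ →
    let U = outer a₁ (combination c₁); V = outer a₂ (combination c₂) in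
    Separated U V → T (manyCollisions U V As) → Any (PointwiseEq3 As) L
  L-complete As c₁ c₂ a₁ a₂ separated many = concatMap⁺ badMatrices (Any.map in-badMatrices
    (cartesianProduct⁺ (∈-combinations c₁ c₂) (cartesianProduct⁺ (∈-vectors a₁) (∈-vectors a₂))))
    where
    in-badMatrices : ∀ {τ} → (((c₁ , c₂) ≡_) ⟨×⟩ ((λ a → ∀ r → a₁ r ≡ a r) ⟨×⟩ (λ a → ∀ r → a₂ r ≡ a r))) τ →
                     Any (PointwiseEq3 As) (badMatrices τ)
    in-badMatrices {τ@(_ , _)} (refl , a₁≡ , a₂≡) = badMatrices-complete τ As
      (outer-congˡ (combination c₁) a₁≡) (outer-congˡ (combination c₂) a₂≡) separated many

  cover : BadCoveredBy k m ℓ n B L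
  cover As not-good = decidable-stable (any? (pointwise? As) L) λ uncovered →
    not-good λ γ₁ γ₂ γ₃ γ₄ i₁ i₂ i₃ i₄ b₁≉b₂ a₁ a₂ independent → decidable-stable (_ ≤? _) λ close →
      uncovered (L-complete As ((γ₁ , i₁) , (γ₂ , i₂)) ((γ₃ , i₃) , (γ₄ , i₄)) a₁ a₂
        (outer-separated a₁ a₂ _ _ b₁≉b₂ independent) (close⇒manyCollisions As a₁ a₂ _ _ close))
    where
    pointwise? : ∀ As As′ → Dec (PointwiseEq3 As As′)
    pointwise? As As′ = Finₚ.all? λ i → Finₚ.all? λ r → Finₚ.all? λ c → As i r c Finₚ.≟ As′ i r c

  n*length-L≤ : 2 ^ (12 * k) < q → n ^ 12 ≤ q ^ ℓ → n * length L ≤ q ^ (4 + k + k) * q ^ (ℓ * k * m)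
  n*length-L≤ q-large n¹²≤qˡ = m⁵*n≤m⁴*o⇒m*n≤o n (begin
    n ^ 5 * length L                                     ≤⟨ n⁵*length-L≤ q-large n¹²≤qˡ ⟩
    length configs * length matrices ^ ℓ                 ≡⟨ cong₂ _*_ length-configs length-matrices^ℓ ⟩
    n ^ 4 * q ^ (4 + k + k) * q ^ (ℓ * k * m)            ≡⟨ *-assoc (n ^ 4) _ _ ⟩
    n ^ 4 * (q ^ (4 + k + k) * q ^ (ℓ * k * m))          ∎)
    where open ≤-Reasoning

proposition4p3 :
    ∃[ c₀ ] (∀ (k Q c₂ : ℕ) → ∃[ C ] (∀ (q : ℕ) {{_ : NonZero q}} → Prime q → 2 ^ (12 * k) < q → q ≤ Q →
      ∀ (n m ℓ : ℕ) → c₀ * (k * k * ⌈log₂ n ⌉) ≤ m → m ≤ c₂ * (k * k * ⌈log₂ n ⌉) →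
      IsCeil12Log q n ℓ →
      ∀ (B : Fin n → Fin m → 𝔽 q) → InjectiveFamily B →
      ∃[ L ] (BadCoveredBy k m ℓ n B L × n * length L ≤ C * q ^ (ℓ * k * m))))
proposition4p3 = 0 , λ k Q c₂ → Q ^ (4 + k + k) , λ q ⦃ _ ⦄ prime q-large q≤Q n m ℓ _ _ (n¹²≤qˡ , _) B _ →
  let open BadChoices q prime k m ℓ n B in
  L , cover , ≤-trans (n*length-L≤ q-large n¹²≤qˡ) (*-monoˡ-≤ (q ^ (ℓ * k * m)) (^-monoˡ-≤ (4 + k + k) q≤Q))
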